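{- A function $f\colon[0,1]\to\mathbb{R}$ is uniformly continuous if and only if the composition $f\circ\Phi\colon\{0,1,2\}^{\mathbb{N}}\to\mathbb{R}$ is uniformly continuous.
   Context: The setting is constructive. Real numbers are regular sequences of rationals $\langle r_n\rangle$ with $|r_n-r_{n+1}|\le2^{ -(n+1)}$. Equality is $\langle r_n\rangle\simeq\langle q_n\rangle$ iff $\forall n\,|r_{n+1}-q_{n+1}|\le2^{ -n}$. Order is the usual constructive one. Functions $[0,1]\to\mathbb{R}$ respect $\simeq$. For $s\in\{0,1,2\}^*$, define $N(\langle\rangle)=1$ and $N(s*\langle i\rangle)=2N(s)+(i-1)$. For $\alpha\in\{0,1,2\}^{\mathbb{N}}$, $\Phi(\alpha)=\langle2^{ -(n+1)}N(\overline{\alpha}n)\rangle_n\in[0,1]$, where $\overline{\alpha}n$ is the initial segment of length $n$. $f\colon[0,1]\to\mathbb{R}$ is uniformly continuous if there is $\omega\colon\mathbb{N}\to\mathbb{N}$ with $\forall k\,\forall x,y\in[0,1]\,(|x-y|\le2^{ -\omega(k)}\to|f(x)-f(y)|\le2^{ -k})$. $h\colon\{0,1,2\}^{\mathbb{N}}\to\mathbb{R}$ is uniformly continuous if there is $\omega\colon\mathbb{N}\to\mathbb{N}$ with $\forall k\,\forall\alpha,\beta\,(\overline{\alpha}\omega(k)=\overline{\beta}\omega(k)\to|h(\alpha)-h(\beta)|\le2^{ -k})$. -}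

module Defs where

open import Data.Nat as ℕ using (ℕ; zero; suc; nonZero)
import Data.Nat.Properties as ℕP
open import Data.Integer as ℤ using (ℤ; +_)
import Data.Integer.Properties as ℤP
open import Data.Integer.Tactic.RingSolver using (solve-∀)
open import Data.Fin using (Fin; toℕ; zero; suc)
open import Data.List using (List; foldl; applyUpTo)
import Data.List.Properties as LP
open import Data.Rational.Unnormalised as ℚ
  using (ℚᵘ; mkℚᵘ; _≤_; _+_; _-_; -_; ∣_∣; 0ℚᵘ; 1ℚᵘ; *≡*; *≤*)
import Data.Rational.Unnormalised.Properties as ℚP
open import Data.Product using (Σ; _×_; _,_; proj₁; proj₂)
open import Relation.Binary.PropositionalEquality
open import Function using (_∘_)

2^n≢0 : ∀ (n : ℕ) → ℕ.NonZero (2 ℕ.^ n)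
2^n≢0 n = ℕP.m^n≢0 2 n

2^- : ℕ → ℚᵘ
2^- n = ((+ 1) ℚ./ (2 ℕ.^ n)) {{2^n≢0 n}}

Seq : Set
Seq = ℕ → ℚᵘ

IsRegular : Seq → Set
IsRegular r = ∀ n → ∣ r n - r (suc n) ∣ ≤ 2^- (suc n)

record ℝ : Set where
  constructor mkℝ
  field
    seq     : Seq
    regular : IsRegular seq
open ℝ public

_≃ʳ_ : ℝ → ℝ → Set
x ≃ʳ y = ∀ n → ∣ seq x (suc n) - seq y (suc n) ∣ ≤ 2^- n

constˢ : ℚᵘ → Seq
constˢ q _ = q

_-ˢ_ : Seq → Seq → Seq
(x -ˢ y) n = x (suc n) - y (suc n)

∣_∣ˢ : Seq → Seq
∣ x ∣ˢ n = ∣ x n ∣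

NonNegˢ : Seq → Set
NonNegˢ x = ∀ n → - 2^- n ≤ x n

_≤ˢ_ : Seq → Seq → Set
x ≤ˢ y = NonNegˢ (y -ˢ x)

Dist≤ : ℝ → ℝ → ℚᵘ → Set
Dist≤ x y q = ∣ seq x -ˢ seq y ∣ˢ ≤ˢ constˢ q

In01 : ℝ → Set
In01 x = (constˢ 0ℚᵘ ≤ˢ seq x) × (seq x ≤ˢ constˢ 1ℚᵘ)

I01 : Set
I01 = Σ ℝ In01

RespectsEq : (I01 → ℝ) → Set
RespectsEq f = ∀ (x y : I01) → proj₁ x ≃ʳ proj₁ y → f x ≃ʳ f y

UniformlyContinuousI : (I01 → ℝ) → Set
UniformlyContinuousI f =
  Σ (ℕ → ℕ) λ ω → ∀ k (x y : I01) →
    Dist≤ (proj₁ x) (proj₁ y) (2^- (ω k)) → Dist≤ (f x) (f y) (2^- k)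

𝟛ᴺ : Set
𝟛ᴺ = ℕ → Fin 3

initSeg : 𝟛ᴺ → ℕ → List (Fin 3)
initSeg α n = applyUpTo α n

UniformlyContinuous𝟛 : (𝟛ᴺ → ℝ) → Set
UniformlyContinuous𝟛 h =
  Σ (ℕ → ℕ) λ ω → ∀ k (α β : 𝟛ᴺ) →
    initSeg α (ω k) ≡ initSeg β (ω k) → Dist≤ (h α) (h β) (2^- k)

N : List (Fin 3) → ℤ
N s = foldl (λ a i → (+ 2) ℤ.* a ℤ.+ ((+ toℕ i) ℤ.- (+ 1))) (+ 1) s

Φseq : 𝟛ᴺ → Seq
Φseq α n = (N (initSeg α n) ℚ./ (2 ℕ.^ suc n)) {{2^n≢0 (suc n)}}

cF : Fin 3 → ℤ
cF i = (+ toℕ i) ℤ.- (+ 1)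

N-step : ∀ α n → N (initSeg α (suc n)) ≡ (+ 2) ℤ.* N (initSeg α n) ℤ.+ cF (α n)
N-step α n = begin
    N (applyUpTo α (suc n))
  ≡⟨ cong N (sym (LP.applyUpTo-∷ʳ α n)) ⟩
    N (Data.List._∷ʳ_ (applyUpTo α n) (α n))
  ≡⟨ LP.foldl-∷ʳ _ (+ 1) (α n) (applyUpTo α n) ⟩
    (+ 2) ℤ.* N (initSeg α n) ℤ.+ cF (α n) ∎
  where open ≡-Reasoning

ring1 : ∀ (M c d : ℤ) → (M ℤ.* ((+ 2) ℤ.* d) ℤ.+ (ℤ.- ((+ 2) ℤ.* M ℤ.+ c)) ℤ.* d) ℤ.* ((+ 2) ℤ.* d)
                         ≡ (ℤ.- c) ℤ.* (d ℤ.* ((+ 2) ℤ.* d))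
ring1 = solve-∀

lem-step : ∀ (a : ℕ) (M c : ℤ) →
  (M ℚ./ suc a) - (((+ 2) ℤ.* M ℤ.+ c) ℚ./ (2 ℕ.* suc a)) ℚ.≃ ((ℤ.- c) ℚ./ (2 ℕ.* suc a))
lem-step a M c = *≡* eq
  where
  D = suc a
  eq : (M ℤ.* (+ (2 ℕ.* D)) ℤ.+ (ℤ.- ((+ 2) ℤ.* M ℤ.+ c)) ℤ.* (+ D)) ℤ.* (+ (2 ℕ.* D))
       ≡ (ℤ.- c) ℤ.* (+ (D ℕ.* (2 ℕ.* D)))
  eq rewrite ℤP.pos-* D (2 ℕ.* D) | ℤP.pos-* 2 D = ring1 M c (+ D)

half≤ : ∀ a → (+ 1) ℚ./ (2 ℕ.* suc a) ≤ (+ 1) ℚ./ suc a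
half≤ a = *≤* (ℤ.+≤+ (ℕP.*-monoʳ-≤ 1 (ℕP.m≤n*m (suc a) 2)))

zero≤ : ∀ a → (+ 0) ℚ./ (2 ℕ.* suc a) ≤ (+ 1) ℚ./ suc a
zero≤ a = *≤* (ℤ.+≤+ ℕ.z≤n)

bnd : ∀ a (i : Fin 3) → ∣ (ℤ.- cF i) ℚ./ (2 ℕ.* suc a) ∣ ≤ (+ 1) ℚ./ suc a
bnd a zero = half≤ a
bnd a (suc zero) = zero≤ a
bnd a (suc (suc zero)) = half≤ a

gen : ∀ D .{{nz : ℕ.NonZero D}} M i →
  ∣ (M ℚ./ D) - (((+ 2) ℤ.* M ℤ.+ cF i) ℚ./ (2 ℕ.* D)) {{ℕP.m*n≢0 2 D}} ∣ ≤ (+ 1) ℚ./ D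
gen (suc a) M i = ℚP.≤-respˡ-≃ (ℚP.≃-sym (ℚP.∣-∣-cong (lem-step a M (cF i)))) (bnd a i)

Φ-reg : ∀ α → IsRegular (Φseq α)
Φ-reg α n rewrite N-step α n = gen (2 ℕ.^ suc n) {{2^n≢0 (suc n)}} (N (initSeg α n)) (α n)

c≥-1 : ∀ i → ℤ.-[1+ 0 ] ℤ.≤ cF i
c≥-1 zero = ℤ.-≤- ℕ.z≤n
c≥-1 (suc zero) = ℤ.-≤+
c≥-1 (suc (suc zero)) = ℤ.-≤+

c-1≤0 : ∀ i → cF i ℤ.- (+ 1) ℤ.≤ + 0
c-1≤0 zero = ℤ.-≤+
c-1≤0 (suc zero) = ℤ.-≤+
c-1≤0 (suc (suc zero)) = ℤ.+≤+ ℕ.z≤n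

ring2 : ∀ (M c : ℤ) → (+ 2) ℤ.* M ℤ.+ c ≡ M ℤ.+ (M ℤ.+ c)
ring2 = solve-∀

ring3 : ∀ (M c : ℤ) → ((+ 2) ℤ.* M ℤ.+ c) ℤ.+ (+ 1) ≡ ((M ℤ.+ (+ 1)) ℤ.+ (M ℤ.+ (+ 1))) ℤ.+ (c ℤ.- (+ 1))
ring3 = solve-∀

ring4 : ∀ (P : ℤ) → (P ℤ.+ P) ℤ.+ (+ 0) ≡ (+ 2) ℤ.* P
ring4 = solve-∀

low : ∀ M i → (+ 1) ℤ.≤ M → (+ 1) ℤ.≤ (+ 2) ℤ.* M ℤ.+ cF i
low M i h = begin
    + 1                          ≡⟨⟩
    (+ 1) ℤ.+ ((+ 1) ℤ.+ ℤ.-[1+ 0 ]) ≤⟨ ℤP.+-mono-≤ h (ℤP.+-mono-≤ h (c≥-1 i)) ⟩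
    M ℤ.+ (M ℤ.+ cF i)           ≡⟨ sym (ring2 M (cF i)) ⟩
    (+ 2) ℤ.* M ℤ.+ cF i ∎
  where open ℤP.≤-Reasoning

up : ∀ M P i → M ℤ.+ (+ 1) ℤ.≤ + P → ((+ 2) ℤ.* M ℤ.+ cF i) ℤ.+ (+ 1) ℤ.≤ + (2 ℕ.* P)
up M P i h = begin
    ((+ 2) ℤ.* M ℤ.+ cF i) ℤ.+ (+ 1)  ≡⟨ ring3 M (cF i) ⟩
    ((M ℤ.+ (+ 1)) ℤ.+ (M ℤ.+ (+ 1))) ℤ.+ (cF i ℤ.- (+ 1)) ≤⟨ ℤP.+-mono-≤ (ℤP.+-mono-≤ h h) (c-1≤0 i) ⟩
    (+ P ℤ.+ + P) ℤ.+ (+ 0)  ≡⟨ ring4 (+ P) ⟩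
    (+ 2) ℤ.* (+ P)  ≡⟨ sym (ℤP.pos-* 2 P) ⟩
    + (2 ℕ.* P) ∎
  where open ℤP.≤-Reasoning

N-bounds : ∀ α m → ((+ 1) ℤ.≤ N (initSeg α m)) × (N (initSeg α m) ℤ.+ (+ 1) ℤ.≤ + (2 ℕ.^ suc m))
N-bounds α zero = ℤP.≤-refl , ℤP.≤-refl
N-bounds α (suc m) rewrite N-step α m =
  let (l , u) = N-bounds α m in
  low (N (initSeg α m)) (α m) l , up (N (initSeg α m)) (2 ℕ.^ suc m) (α m) u

0≤/ : ∀ D .{{nz : ℕ.NonZero D}} M → (+ 0) ℤ.≤ M → 0ℚᵘ ≤ (M ℚ./ D)
0≤/ (suc a) M h = *≤* (subst ((+ 0) ℤ.≤_) (sym (ℤP.*-identityʳ M)) h)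

/≤1 : ∀ D .{{nz : ℕ.NonZero D}} M → M ℤ.≤ (+ D) → (M ℚ./ D) ≤ 1ℚᵘ
/≤1 (suc a) M h = *≤* (subst₂ ℤ._≤_ (sym (ℤP.*-identityʳ M)) (sym (ℤP.*-identityˡ (+ suc a))) h)

-2^-≤0 : ∀ n → - 2^- n ≤ 0ℚᵘ
-2^-≤0 n = ℚP.neg-mono-≤ (0≤/ (2 ℕ.^ n) {{2^n≢0 n}} (+ 1) (ℤ.+≤+ ℕ.z≤n))

Φ≥0 : ∀ α m → 0ℚᵘ ≤ Φseq α m
Φ≥0 α m = 0≤/ (2 ℕ.^ suc m) {{2^n≢0 (suc m)}} (N (initSeg α m))
            (ℤP.≤-trans (ℤ.+≤+ ℕ.z≤n) (proj₁ (N-bounds α m)))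

Φ≤1 : ∀ α m → Φseq α m ≤ 1ℚᵘ
Φ≤1 α m = /≤1 (2 ℕ.^ suc m) {{2^n≢0 (suc m)}} (N (initSeg α m))
            (ℤP.≤-trans (ℤP.i≤i+j (N (initSeg α m)) (+ 1)) (proj₂ (N-bounds α m)))

Φ-in01 : ∀ α → In01 (mkℝ (Φseq α) (Φ-reg α))
Φ-in01 α = (λ n → ℚP.≤-trans (-2^-≤0 n)
                    (ℚP.≤-respʳ-≃ (ℚP.≃-sym (ℚP.+-identityʳ (Φseq α (suc n)))) (Φ≥0 α (suc n))))
         , (λ n → ℚP.≤-trans (-2^-≤0 n) (ℚP.p≤q⇒0≤q-p (Φ≤1 α (suc n))))

Φ : 𝟛ᴺ → I01
Φ α = mkℝ (Φseq α) (Φ-reg α) , Φ-in01 α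

-- Φ reads the digit i as a step of size i - 1 in a dyadic walk: Φ(α)_(n+1) is
-- Φ(α)_n moved by -2^-(n+2), 0 or 2^-(n+2). Sequences sharing a prefix of length
-- w + 1 share Φ(α)_(w+1), so Φ is uniformly continuous and f ∘ Φ inherits a
-- modulus from f. Conversely every x ∈ [0,1] is the limit of a walk that keeps
-- Φ(α)_n within 2^-(n+1) of x: given a rational interval of length at most
-- 2^-(n+2) containing x, step towards it when Φ(α)_n lies outside it and stay
-- put otherwise. Points within 2^-(m+3) of each other share such an interval for
-- all stages n < m, hence are images of sequences with a common prefix of length
-- m, and a modulus ω for f ∘ Φ gives the modulus ω + 3 for f.
module Submission where

open import Defs
open import Function using (_∘_)
open import Function.Bundles using (_⇔_; mk⇔)
open import Data.Nat as ℕ using (ℕ; zero; suc)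
import Data.Nat.Properties as ℕP
open import Data.Integer as ℤ using (ℤ; +_)
import Data.Integer.Properties as ℤP
open import Data.Integer.Tactic.RingSolver using (solve-∀)
open import Data.Rational.Unnormalised as ℚ
  using (ℚᵘ; _≤_; _≃_; _+_; _-_; -_; ∣_∣; 0ℚᵘ; 1ℚᵘ; *≡*; *≤*)
import Data.Rational.Unnormalised.Properties as ℚP
open import Data.Rational.Unnormalised.Solver using (module +-*-Solver)
open import Data.Fin using (Fin; zero; suc)
open import Data.List using (_∷_; applyUpTo)
open import Data.Product using (Σ-syntax; _×_; _,_; proj₁; proj₂)
open import Data.Sum using (inj₁; inj₂)
open import Relation.Nullary using (yes; no; contradiction)
open import Relation.Binary.PropositionalEquality

open +-*-Solver

private variable
  p q r s t : ℚᵘ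

-- Linear inequalities are proved by writing q - p as a sum of non-negative terms.
≤-witness : ∀ w → 0ℚᵘ ≤ w → w ≃ q - p → p ≤ q
≤-witness w 0≤w w≃q-p = ℚP.0≤q-p⇒p≤q (ℚP.≤-respʳ-≃ w≃q-p 0≤w)

gap : p ≤ q → 0ℚᵘ ≤ q - p
gap = ℚP.p≤q⇒0≤q-p

infixl 6 _⊕_
_⊕_ : 0ℚᵘ ≤ p → 0ℚᵘ ≤ q → 0ℚᵘ ≤ p + q
_⊕_ = ℚP.+-mono-≤

p-q≤p+q : ∀ {p q} → 0ℚᵘ ≤ q → p - q ≤ p + q
p-q≤p+q {p} {q} 0≤q =
  ≤-witness _ (0≤q ⊕ 0≤q) (solve 2 (λ p q → q :+ q := (p :+ q) :- (p :- q)) ℚP.≃-refl p q)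

-- Closeness of rationals

infix 4 _≈[_]_
_≈[_]_ : ℚᵘ → ℚᵘ → ℚᵘ → Set
p ≈[ t ] q = (p ≤ q + t) × (q ≤ p + t)

≈-sym : p ≈[ t ] q → q ≈[ t ] p
≈-sym (p≤q+t , q≤p+t) = q≤p+t , p≤q+t

≈-weaken : s ≤ t → p ≈[ s ] q → p ≈[ t ] q
≈-weaken {p = p} {q = q} s≤t (p≤q+s , q≤p+s) =
  ℚP.≤-trans p≤q+s (ℚP.+-monoʳ-≤ q s≤t) , ℚP.≤-trans q≤p+s (ℚP.+-monoʳ-≤ p s≤t)

≤-+-trans : ∀ {p q r s t} → p ≤ q + s → q ≤ r + t → p ≤ r + (t + s)
≤-+-trans {p} {q} {r} {s} {t} p≤q+s q≤r+t = begin
  p             ≤⟨ p≤q+s ⟩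
  q + s         ≤⟨ ℚP.+-monoˡ-≤ s q≤r+t ⟩
  (r + t) + s   ≃⟨ ℚP.+-assoc r t s ⟩
  r + (t + s)   ∎
  where open ℚP.≤-Reasoning

≈-trans : ∀ {p q r s t} → p ≈[ s ] q → q ≈[ t ] r → p ≈[ s + t ] r
≈-trans {p} {q} {r} {s} {t} (p≤q+s , q≤p+s) (q≤r+t , r≤q+t) =
    ℚP.≤-respʳ-≃ (ℚP.+-congʳ r (ℚP.+-comm t s)) (≤-+-trans {r = r} p≤q+s q≤r+t)
  , ≤-+-trans {r = p} r≤q+t q≤p+s

≈-respʳ-≃ : q ≃ r → p ≈[ t ] q → p ≈[ t ] r
≈-respʳ-≃ {t = t} q≃r (p≤q+t , q≤p+t) =
  ℚP.≤-respʳ-≃ (ℚP.+-congˡ t q≃r) p≤q+t , ℚP.≤-respˡ-≃ q≃r q≤p+t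

p≤∣p∣ : ∀ p → p ≤ ∣ p ∣
p≤∣p∣ p with ℚP.∣p∣≡p∨∣p∣≡-p p
... | inj₁ ∣p∣≡p = ℚP.≤-reflexive-≡ (sym ∣p∣≡p)
... | inj₂ ∣p∣≡-p rewrite ∣p∣≡-p =
  ≤-witness _ (0≤-p ⊕ 0≤-p) (solve 1 (λ p → (:- p) :+ (:- p) := (:- p) :- p) ℚP.≃-refl p)
  where 0≤-p = subst (0ℚᵘ ≤_) ∣p∣≡-p (ℚP.0≤∣p∣ p)

-p≤∣p∣ : ∀ p → - p ≤ ∣ p ∣
-p≤∣p∣ p = subst (- p ≤_) (ℚP.∣-p∣≡∣p∣ p) (p≤∣p∣ (- p))

∣-∣≤⇒≈ : ∣ p - q ∣ ≤ t → p ≈[ t ] q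
∣-∣≤⇒≈ {p} {q} {t} ∣p-q∣≤t =
    ≤-witness _ (gap (ℚP.≤-trans (p≤∣p∣ (p - q)) ∣p-q∣≤t))
      (solve 3 (λ p q t → t :- (p :- q) := (q :+ t) :- p) ℚP.≃-refl p q t)
  , ≤-witness _ (gap (ℚP.≤-trans (-p≤∣p∣ (p - q)) ∣p-q∣≤t))
      (solve 3 (λ p q t → t :- (:- (p :- q)) := (p :+ t) :- q) ℚP.≃-refl p q t)

≈⇒∣-∣≤ : p ≈[ t ] q → ∣ p - q ∣ ≤ t
≈⇒∣-∣≤ {p} {t} {q} (p≤q+t , q≤p+t) with ℚP.∣p∣≡p∨∣p∣≡-p (p - q)
... | inj₁ ∣p-q∣≡p-q rewrite ∣p-q∣≡p-q = ≤-witness _ (gap p≤q+t)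
        (solve 3 (λ p q t → (q :+ t) :- p := t :- (p :- q)) ℚP.≃-refl p q t)
... | inj₂ ∣p-q∣≡q-p rewrite ∣p-q∣≡q-p = ≤-witness _ (gap q≤p+t)
        (solve 3 (λ p q t → (p :+ t) :- q := t :- (:- (p :- q))) ℚP.≃-refl p q t)

0≤2^- : ∀ n → 0ℚᵘ ≤ 2^- n
0≤2^- n = 0≤/ (2 ℕ.^ n) {{2^n≢0 n}} (+ 1) (ℤ.+≤+ ℕ.z≤n)

2^-‿halves : ∀ n → 2^- (suc n) + 2^- (suc n) ≃ 2^- n
2^-‿halves n = halves (2 ℕ.^ n) {{2^n≢0 n}}
  where
  halves : ∀ d .{{_ : ℕ.NonZero d}} →
    ((+ 1) ℚ./ (2 ℕ.* d)) {{ℕP.m*n≢0 2 d}} + ((+ 1) ℚ./ (2 ℕ.* d)) {{ℕP.m*n≢0 2 d}}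
    ≃ (+ 1) ℚ./ d
  halves (suc a) = *≡* eq
    where
    d = suc a
    ring : ∀ (d : ℤ) → ((+ 1) ℤ.* ((+ 2) ℤ.* d) ℤ.+ (+ 1) ℤ.* ((+ 2) ℤ.* d)) ℤ.* d
                       ≡ (+ 1) ℤ.* (((+ 2) ℤ.* d) ℤ.* ((+ 2) ℤ.* d))
    ring = solve-∀
    eq : ((+ 1) ℤ.* (+ (2 ℕ.* d)) ℤ.+ (+ 1) ℤ.* (+ (2 ℕ.* d))) ℤ.* (+ d)
         ≡ (+ 1) ℤ.* (+ (2 ℕ.* d ℕ.* (2 ℕ.* d)))
    eq rewrite ℤP.pos-* (2 ℕ.* d) (2 ℕ.* d) | ℤP.pos-* 2 d = ring (+ d)

2^-‿antitone : ∀ {m n} → m ℕ.≤ n → 2^- n ≤ 2^- m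
2^-‿antitone {m} {n} m≤n = antitone {{2^n≢0 m}} {{2^n≢0 n}} (ℕP.^-monoʳ-≤ 2 m≤n)
  where
  antitone : ∀ {d e} .{{_ : ℕ.NonZero d}} .{{_ : ℕ.NonZero e}} →
             d ℕ.≤ e → (+ 1) ℚ./ e ≤ (+ 1) ℚ./ d
  antitone {suc _} {suc _} d≤e = *≤* (ℤ.+≤+ (ℕP.*-monoʳ-≤ 1 d≤e))

2^-‿suc≤ : ∀ n → 2^- (suc n) ≤ 2^- n
2^-‿suc≤ n = 2^-‿antitone (ℕP.n≤1+n n)

2^-‿suc+2^-‿suc≤ : ∀ {m n} → m ℕ.≤ n → 2^- (suc m) + 2^- (suc n) ≤ 2^- m
2^-‿suc+2^-‿suc≤ {m} m≤n =
  ℚP.≤-trans (ℚP.+-monoʳ-≤ (2^- (suc m)) (2^-‿antitone (ℕ.s≤s m≤n)))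
             (ℚP.≤-reflexive (2^-‿halves m))

-- Distances between reals

ℚ→ℝ : ℚᵘ → ℝ
ℚ→ℝ q = mkℝ (constˢ q) λ n →
  ℚP.≤-respˡ-≃ (ℚP.≃-sym (ℚP.∣-∣-cong (ℚP.+-inverseʳ q))) (0≤2^- (suc n))

≈-telescope : ∀ x i d → seq x i ≈[ 2^- i - 2^- (d ℕ.+ i) ] seq x (d ℕ.+ i)
≈-telescope x i zero = ∣-∣≤⇒≈ (ℚP.≤-reflexive (begin-equality
  ∣ seq x i - seq x i ∣  ≃⟨ ℚP.∣-∣-cong (ℚP.+-inverseʳ (seq x i)) ⟩
  0ℚᵘ                    ≃⟨ ℚP.≃-sym (ℚP.+-inverseʳ (2^- i)) ⟩
  2^- i - 2^- i          ∎))
  where open ℚP.≤-Reasoning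
≈-telescope x i (suc d) =
  ≈-weaken (ℚP.≤-reflexive budget)
    (≈-trans (≈-telescope x i d) (∣-∣≤⇒≈ (regular x (d ℕ.+ i))))
  where
  h = 2^- (suc d ℕ.+ i)
  budget : (2^- i - 2^- (d ℕ.+ i)) + h ≃ 2^- i - h
  budget = begin-equality
      (2^- i - 2^- (d ℕ.+ i)) + h
    ≃⟨ ℚP.+-congˡ h (ℚP.+-congʳ (2^- i) (ℚP.-‿cong (ℚP.≃-sym (2^-‿halves (d ℕ.+ i))))) ⟩
      (2^- i - (h + h)) + h
    ≃⟨ solve 2 (λ a h → (a :- (h :+ h)) :+ h := a :- h) ℚP.≃-refl (2^- i) h ⟩
      2^- i - h
    ∎
    where open ℚP.≤-Reasoning

regular-≈ : ∀ x i j → seq x i ≈[ 2^- i + 2^- j ] seq x j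
regular-≈ x i j with ℕP.≤-total i j
... | inj₁ i≤j = subst (λ k → seq x i ≈[ 2^- i + 2^- k ] seq x k) (ℕP.m∸n+n≡m i≤j)
                   (≈-weaken (p-q≤p+q {2^- i} (0≤2^- (j ℕ.∸ i ℕ.+ i)))
                             (≈-telescope x i (j ℕ.∸ i)))
... | inj₂ j≤i = subst (λ k → seq x k ≈[ 2^- k + 2^- j ] seq x j) (ℕP.m∸n+n≡m j≤i)
                   (≈-sym (≈-weaken (ℚP.≤-respʳ-≃ (ℚP.+-comm (2^- j) _)
                                                  (p-q≤p+q {2^- j} (0≤2^- (i ℕ.∸ j ℕ.+ j))))
                                    (≈-telescope x j (i ℕ.∸ j))))

Dist≤⇒≈ : ∀ {x y q} → Dist≤ x y q → ∀ n → seq x (2 ℕ.+ n) ≈[ q + 2^- n ] seq y (2 ℕ.+ n)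
Dist≤⇒≈ {x} {y} {q} x~y n = ∣-∣≤⇒≈ (≤-witness _ (gap (x~y n))
  (solve 3 (λ q d e → (q :- d) :- (:- e) := (q :+ e) :- d) ℚP.≃-refl
     q (∣ seq x (2 ℕ.+ n) - seq y (2 ℕ.+ n) ∣) (2^- n)))

≈⇒Dist≤ : ∀ {x y q} → (∀ n → seq x (2 ℕ.+ n) ≈[ q + 2^- n ] seq y (2 ℕ.+ n)) → Dist≤ x y q
≈⇒Dist≤ {x} {y} {q} x≈y n = ≤-witness _ (gap (≈⇒∣-∣≤ (x≈y n)))
  (solve 3 (λ q d e → (q :+ e) :- d := (q :- d) :- (:- e)) ℚP.≃-refl
     q (∣ seq x (2 ℕ.+ n) - seq y (2 ℕ.+ n) ∣) (2^- n))

Dist≤-sym : ∀ {x y q} → Dist≤ x y q → Dist≤ y x q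
Dist≤-sym {x} {y} {q} x~y = ≈⇒Dist≤ {y} {x} {q} (λ n → ≈-sym (Dist≤⇒≈ {x} {y} {q} x~y n))

Dist≤-mono : ∀ {x y q r} → q ≤ r → Dist≤ x y q → Dist≤ x y r
Dist≤-mono {x} {y} {q} {r} q≤r x~y =
  ≈⇒Dist≤ {x} {y} {r} λ n → ≈-weaken (ℚP.+-monoˡ-≤ (2^- n) q≤r) (Dist≤⇒≈ {x} {y} {q} x~y n)

Dist≤-trans : ∀ {x y z s t} → Dist≤ x y s → Dist≤ y z t → Dist≤ x z (s + t)
Dist≤-trans {x} {y} {z} {s} {t} x~y y~z = ≈⇒Dist≤ {x} {z} {s + t} λ n →
  ≈-weaken (budget n)
    (≈-trans (≈-trans (≈-trans (regular-≈ x (2 ℕ.+ n) (5 ℕ.+ n))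
                               (Dist≤⇒≈ {x} {y} {s} x~y (3 ℕ.+ n)))
                      (Dist≤⇒≈ {y} {z} {t} y~z (3 ℕ.+ n)))
             (regular-≈ z (5 ℕ.+ n) (2 ℕ.+ n)))
  where
  budget : ∀ n → (((2^- (2 ℕ.+ n) + 2^- (5 ℕ.+ n)) + (s + 2^- (3 ℕ.+ n))) + (t + 2^- (3 ℕ.+ n)))
                   + (2^- (5 ℕ.+ n) + 2^- (2 ℕ.+ n))
                 ≤ (s + t) + 2^- n
  budget n = begin
      (((e₂ + e₅) + (s + e₃)) + (t + e₃)) + (e₅ + e₂)
    ≃⟨ solve 5 (λ s t e₂ e₃ e₅ → (((e₂ :+ e₅) :+ (s :+ e₃)) :+ (t :+ e₃)) :+ (e₅ :+ e₂)
                                 := (s :+ t) :+ ((e₂ :+ e₂) :+ ((e₃ :+ e₃) :+ (e₅ :+ e₅))))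
               ℚP.≃-refl s t e₂ e₃ e₅ ⟩
      (s + t) + ((e₂ + e₂) + ((e₃ + e₃) + (e₅ + e₅)))
    ≃⟨ ℚP.+-congʳ (s + t) (ℚP.+-cong (2^-‿halves (1 ℕ.+ n))
                            (ℚP.+-cong (2^-‿halves (2 ℕ.+ n)) (2^-‿halves (4 ℕ.+ n)))) ⟩
      (s + t) + (2^- (1 ℕ.+ n) + (2^- (2 ℕ.+ n) + 2^- (4 ℕ.+ n)))
    ≤⟨ ℚP.+-monoʳ-≤ (s + t)
         (ℚP.+-monoʳ-≤ (2^- (1 ℕ.+ n)) (2^-‿suc+2^-‿suc≤ {1 ℕ.+ n} (ℕP.m≤n+m (1 ℕ.+ n) 2))) ⟩
      (s + t) + (2^- (1 ℕ.+ n) + 2^- (1 ℕ.+ n))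
    ≃⟨ ℚP.+-congʳ (s + t) (2^-‿halves n) ⟩
      (s + t) + 2^- n
    ∎
    where
    open ℚP.≤-Reasoning
    e₂ = 2^- (2 ℕ.+ n)
    e₃ = 2^- (3 ℕ.+ n)
    e₅ = 2^- (5 ℕ.+ n)

≃ʳ⇒Dist≤ : ∀ {x y} → x ≃ʳ y → Dist≤ x y 0ℚᵘ
≃ʳ⇒Dist≤ {x} {y} x≃y = ≈⇒Dist≤ {x} {y} {0ℚᵘ} λ n →
  ≈-weaken (ℚP.≤-respʳ-≃ (ℚP.≃-sym (ℚP.+-identityˡ (2^- n))) (2^-‿suc≤ n))
           (∣-∣≤⇒≈ (x≃y (suc n)))

Dist≤-resp-≃ʳ : ∀ {x x′ y y′ q} → x ≃ʳ x′ → y ≃ʳ y′ → Dist≤ x y q → Dist≤ x′ y′ q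
Dist≤-resp-≃ʳ {x} {x′} {y} {y′} {q} x≃x′ y≃y′ x~y =
  Dist≤-mono {x′} {y′} (ℚP.≤-reflexive (solve 1 (λ q → (con 0ℚᵘ :+ q) :+ con 0ℚᵘ := q) ℚP.≃-refl q))
    (Dist≤-trans {x′} {y} {y′} {0ℚᵘ + q} {0ℚᵘ}
      (Dist≤-trans {x′} {x} {y} {0ℚᵘ} {q}
        (Dist≤-sym {x} {x′} {0ℚᵘ} (≃ʳ⇒Dist≤ {x} {x′} x≃x′)) x~y)
      (≃ʳ⇒Dist≤ {y} {y′} y≃y′))

Dist≤-approximant : ∀ x j → Dist≤ x (ℚ→ℝ (seq x j)) (2^- j)
Dist≤-approximant x j = ≈⇒Dist≤ {x} {ℚ→ℝ (seq x j)} {2^- j} λ n →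
  ≈-weaken (ℚP.≤-trans (ℚP.≤-reflexive (ℚP.+-comm (2^- (2 ℕ.+ n)) (2^- j)))
                       (ℚP.+-monoʳ-≤ (2^- j) (2^-‿antitone (ℕP.m≤n+m n 2))))
           (regular-≈ x (2 ℕ.+ n) j)

Dist≤-of-agree : ∀ {x y} w → seq x (suc w) ≡ seq y (suc w) → Dist≤ x y (2^- w)
Dist≤-of-agree {x} {y} w xw≡yw = ≈⇒Dist≤ {x} {y} {2^- w} λ n →
  ≈-weaken (budget n)
    (≈-trans (regular-≈ x (2 ℕ.+ n) (suc w))
             (subst (_≈[ 2^- (suc w) + 2^- (2 ℕ.+ n) ] seq y (2 ℕ.+ n)) (sym xw≡yw)
                    (regular-≈ y (suc w) (2 ℕ.+ n))))
  where
  budget : ∀ n → (2^- (2 ℕ.+ n) + 2^- (suc w)) + (2^- (suc w) + 2^- (2 ℕ.+ n)) ≤ 2^- w + 2^- n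
  budget n = begin
      (e₂ + eʷ) + (eʷ + e₂)   ≃⟨ solve 2 (λ a b → (a :+ b) :+ (b :+ a) := (b :+ b) :+ (a :+ a))
                                        ℚP.≃-refl e₂ eʷ ⟩
      (eʷ + eʷ) + (e₂ + e₂)   ≃⟨ ℚP.+-cong (2^-‿halves w) (2^-‿halves (suc n)) ⟩
      2^- w + 2^- (suc n)     ≤⟨ ℚP.+-monoʳ-≤ (2^- w) (2^-‿suc≤ n) ⟩
      2^- w + 2^- n           ∎
    where
    open ℚP.≤-Reasoning
    e₂ = 2^- (2 ℕ.+ n)
    eʷ = 2^- (suc w)

approximants⇒≃ʳ : ∀ {x y} → (∀ n → Dist≤ x (ℚ→ℝ (seq y n)) (2^- (suc n))) → y ≃ʳ x
approximants⇒≃ʳ {x} {y} x~yₙ n = ≈⇒∣-∣≤ (≈-weaken budget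
  (≈-trans (≈-sym (Dist≤⇒≈ {x} {ℚ→ℝ (seq y (suc n))} {2^- (2 ℕ.+ n)}
                            (x~yₙ (suc n)) (3 ℕ.+ n)))
           (regular-≈ x (5 ℕ.+ n) (suc n))))
  where
  e₁ = 2^- (1 ℕ.+ n)
  e₂ = 2^- (2 ℕ.+ n)
  e₃ = 2^- (3 ℕ.+ n)
  e₅ = 2^- (5 ℕ.+ n)
  budget : (e₂ + e₃) + (e₅ + e₁) ≤ 2^- n
  budget = begin
    (e₂ + e₃) + (e₅ + e₁)   ≃⟨ solve 4 (λ a b c d → (b :+ c) :+ (d :+ a) := a :+ (b :+ (c :+ d)))
                                      ℚP.≃-refl e₁ e₂ e₃ e₅ ⟩
    e₁ + (e₂ + (e₃ + e₅))   ≤⟨ ℚP.+-monoʳ-≤ e₁ (ℚP.+-monoʳ-≤ e₂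
                                 (2^-‿suc+2^-‿suc≤ {2 ℕ.+ n} (ℕP.m≤n+m (2 ℕ.+ n) 2))) ⟩
    e₁ + (e₂ + e₂)          ≤⟨ ℚP.+-monoʳ-≤ e₁ (2^-‿suc+2^-‿suc≤ {1 ℕ.+ n} ℕP.≤-refl) ⟩
    e₁ + e₁                 ≤⟨ 2^-‿suc+2^-‿suc≤ {n} ℕP.≤-refl ⟩
    2^- n                   ∎
    where open ℚP.≤-Reasoning

In01⇒Dist≤½ : ∀ {x} → In01 x → Dist≤ x (ℚ→ℝ (2^- 1)) (2^- 1)
In01⇒Dist≤½ {x} (0≤x , x≤1) = ≈⇒Dist≤ {x} {ℚ→ℝ ½} {½} λ n →
    ≤-witness _ (gap (x≤1 (suc n)) ⊕ gap (2^-‿suc≤ n) ⊕ gap 1≤½+½)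
      (solve 4 (λ x e₀ e₁ h → (((con 1ℚᵘ :- x) :- (:- e₁)) :+ (e₀ :- e₁))
                                :+ ((h :+ h) :- con 1ℚᵘ)
                              := (h :+ (h :+ e₀)) :- x)
         ℚP.≃-refl (seq x (2 ℕ.+ n)) (2^- n) (2^- (suc n)) ½)
  , ≤-witness _ (gap (0≤x (suc n)) ⊕ gap (2^-‿suc≤ n))
      (solve 4 (λ x e₀ e₁ h → ((x :- con 0ℚᵘ) :- (:- e₁)) :+ (e₀ :- e₁)
                              := (x :+ (h :+ e₀)) :- h)
         ℚP.≃-refl (seq x (2 ℕ.+ n)) (2^- n) (2^- (suc n)) ½)
  where
  ½ = 2^- 1
  1≤½+½ : 1ℚᵘ ≤ ½ + ½
  1≤½+½ = ℚP.≤-reflexive (ℚP.≃-sym (2^-‿halves 0))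

-- The walk Φ

shift : Fin 3 → ℚᵘ → ℚᵘ
shift zero             h = - h
shift (suc zero)       h = 0ℚᵘ
shift (suc (suc zero)) h = h

cF/≃shift : ∀ d .{{_ : ℕ.NonZero d}} i → (cF i ℚ./ d) ≃ shift i ((+ 1) ℚ./ d)
cF/≃shift (suc _) zero             = ℚP.≃-refl
cF/≃shift (suc _) (suc zero)       = *≡* refl
cF/≃shift (suc _) (suc (suc zero)) = ℚP.≃-refl

[2M+c]/[2d]≃M/d+c/[2d] : ∀ d .{{_ : ℕ.NonZero d}} M c →
  ((+ 2 ℤ.* M ℤ.+ c) ℚ./ (2 ℕ.* d)) {{ℕP.m*n≢0 2 d}}
  ≃ (M ℚ./ d) + (c ℚ./ (2 ℕ.* d)) {{ℕP.m*n≢0 2 d}}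
[2M+c]/[2d]≃M/d+c/[2d] (suc a) M c = *≡* eq
  where
  d = suc a
  ring : ∀ (M c d : ℤ) → ((+ 2) ℤ.* M ℤ.+ c) ℤ.* (d ℤ.* ((+ 2) ℤ.* d))
                         ≡ (M ℤ.* ((+ 2) ℤ.* d) ℤ.+ c ℤ.* d) ℤ.* ((+ 2) ℤ.* d)
  ring = solve-∀
  eq : ((+ 2) ℤ.* M ℤ.+ c) ℤ.* (+ (d ℕ.* (2 ℕ.* d)))
       ≡ (M ℤ.* (+ (2 ℕ.* d)) ℤ.+ c ℤ.* (+ d)) ℤ.* (+ (2 ℕ.* d))
  eq rewrite ℤP.pos-* d (2 ℕ.* d) | ℤP.pos-* 2 d = ring M c (+ d)

Φseq-suc : ∀ α n → Φseq α (suc n) ≃ Φseq α n + shift (α n) (2^- (2 ℕ.+ n))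
Φseq-suc α n rewrite N-step α n = begin-equality
    ((+ 2 ℤ.* M ℤ.+ cF (α n)) ℚ./ (2 ℕ.* d)) {{ℕP.m*n≢0 2 d}}
  ≃⟨ [2M+c]/[2d]≃M/d+c/[2d] d M (cF (α n)) ⟩
    (M ℚ./ d) + (cF (α n) ℚ./ (2 ℕ.* d)) {{ℕP.m*n≢0 2 d}}
  ≃⟨ ℚP.+-congʳ (M ℚ./ d) (cF/≃shift (2 ℕ.* d) {{ℕP.m*n≢0 2 d}} (α n)) ⟩
    (M ℚ./ d) + shift (α n) (2^- (2 ℕ.+ n))
  ∎
  where
  open ℚP.≤-Reasoning
  d = 2 ℕ.^ suc n
  instance _ = 2^n≢0 (suc n)
  M = N (initSeg α n)

Φ-prefix-Dist≤ : ∀ α β w → initSeg α (suc w) ≡ initSeg β (suc w) →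
                 Dist≤ (proj₁ (Φ α)) (proj₁ (Φ β)) (2^- w)
Φ-prefix-Dist≤ α β w same = Dist≤-of-agree {proj₁ (Φ α)} {proj₁ (Φ β)} w
  (cong (λ s → (N s ℚ./ 2 ℕ.^ suc (suc w)) {{2^n≢0 (suc (suc w))}}) same)

digit : ℚᵘ → ℚᵘ → ℚᵘ → Fin 3
digit c a ρ with c ℚP.≤? a - ρ | a + ρ ℚP.≤? c
... | yes _ | _     = suc (suc zero)
... | no _  | yes _ = zero
... | no _  | no _  = suc zero

digit-step : ∀ {q ε c r h a ρ} → r ≤ h + h → ρ + ρ ≤ h →
  q ≈[ r + ε ] c → q ≈[ ρ + ε ] a → q ≈[ h + ε ] c + shift (digit c a ρ) h
digit-step {q} {ε} {c} {r} {h} {a} {ρ} r≤2h 2ρ≤h (q≤c+r+ε , c≤q+r+ε) (q≤a+ρ+ε , a≤q+ρ+ε)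
  with c ℚP.≤? a - ρ | a + ρ ℚP.≤? c
... | yes c≤a-ρ | _ =
    ≤-witness _ (gap q≤c+r+ε ⊕ gap r≤2h)
      (solve 5 (λ q ε c r h → ((c :+ (r :+ ε)) :- q) :+ ((h :+ h) :- r)
                              := ((c :+ h) :+ (h :+ ε)) :- q)
         ℚP.≃-refl q ε c r h)
  , ≤-witness _ (gap c≤a-ρ ⊕ gap a≤q+ρ+ε)
      (solve 6 (λ q ε c h a ρ → ((a :- ρ) :- c) :+ ((q :+ (ρ :+ ε)) :- a)
                                := (q :+ (h :+ ε)) :- (c :+ h))
         ℚP.≃-refl q ε c h a ρ)
... | no _ | yes a+ρ≤c =
    ≤-witness _ (gap a+ρ≤c ⊕ gap q≤a+ρ+ε)
      (solve 6 (λ q ε c h a ρ → (c :- (a :+ ρ)) :+ ((a :+ (ρ :+ ε)) :- q)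
                                := ((c :+ (:- h)) :+ (h :+ ε)) :- q)
         ℚP.≃-refl q ε c h a ρ)
  , ≤-witness _ (gap c≤q+r+ε ⊕ gap r≤2h)
      (solve 5 (λ q ε c r h → ((q :+ (r :+ ε)) :- c) :+ ((h :+ h) :- r)
                              := (q :+ (h :+ ε)) :- (c :+ (:- h)))
         ℚP.≃-refl q ε c r h)
... | no c≰a-ρ | no a+ρ≰c =
    ≤-witness _ (gap q≤a+ρ+ε ⊕ gap a-ρ≤c ⊕ gap 2ρ≤h)
      (solve 6 (λ q ε c h a ρ → (((a :+ (ρ :+ ε)) :- q) :+ (c :- (a :- ρ))) :+ (h :- (ρ :+ ρ))
                                := ((c :+ con 0ℚᵘ) :+ (h :+ ε)) :- q)
         ℚP.≃-refl q ε c h a ρ)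
  , ≤-witness _ (gap a≤q+ρ+ε ⊕ gap c≤a+ρ ⊕ gap 2ρ≤h)
      (solve 6 (λ q ε c h a ρ → (((q :+ (ρ :+ ε)) :- a) :+ ((a :+ ρ) :- c)) :+ (h :- (ρ :+ ρ))
                                := (q :+ (h :+ ε)) :- (c :+ con 0ℚᵘ))
         ℚP.≃-refl q ε c h a ρ)
  where
  a-ρ≤c = ℚP.≰⇒≥ c≰a-ρ
  c≤a+ρ = ℚP.≰⇒≥ a+ρ≰c

-- Preimages under Φ

-- At stage n a guide proposes the rational interval [a - ρ, a + ρ] as the pair (a , ρ).
Guide : Set
Guide = ℕ → ℚᵘ × ℚᵘ

mutual
  numerator : Guide → ℕ → ℤ
  numerator g zero    = + 1
  numerator g (suc n) = (+ 2) ℤ.* numerator g n ℤ.+ cF (digits g n)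

  digits : Guide → 𝟛ᴺ
  digits g n =
    digit ((numerator g n ℚ./ 2 ℕ.^ suc n) {{2^n≢0 (suc n)}}) (proj₁ (g n)) (proj₂ (g n))

N-digits : ∀ g n → N (initSeg (digits g) n) ≡ numerator g n
N-digits g zero = refl
N-digits g (suc n) rewrite N-step (digits g) n | N-digits g n = refl

digits-spec : ∀ g n → digits g n ≡ digit (Φseq (digits g) n) (proj₁ (g n)) (proj₂ (g n))
digits-spec g n =
  cong (λ M → digit ((M ℚ./ 2 ℕ.^ suc n) {{2^n≢0 (suc n)}}) (proj₁ (g n)) (proj₂ (g n)))
       (sym (N-digits g n))

GuidesAt : ℕ → ℚᵘ × ℚᵘ → ℝ → Set
GuidesAt n (a , ρ) x = Dist≤ x (ℚ→ℝ a) ρ × (ρ + ρ ≤ 2^- (2 ℕ.+ n))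

Guides : Guide → ℝ → Set
Guides g x = ∀ n → GuidesAt n (g n) x

Φseq-digits-Dist≤ : ∀ {g x} → In01 x → Guides g x →
                    ∀ n → Dist≤ x (ℚ→ℝ (Φseq (digits g) n)) (2^- (suc n))
Φseq-digits-Dist≤ {x = x} x∈[0,1] guides zero = In01⇒Dist≤½ {x} x∈[0,1]
Φseq-digits-Dist≤ {g} {x} x∈[0,1] guides (suc n) =
  ≈⇒Dist≤ {x} {ℚ→ℝ (Φseq α (suc n))} {h} λ j →
    ≈-respʳ-≃ (ℚP.≃-sym (Φseq-suc α n))
      (subst (λ i → seq x (2 ℕ.+ j) ≈[ h + 2^- j ] Φseq α n + shift i h)
             (sym (digits-spec g n))
             (digit-step (ℚP.≤-reflexive (ℚP.≃-sym (2^-‿halves (suc n)))) (proj₂ (guides n))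
                (Dist≤⇒≈ {x} {ℚ→ℝ (Φseq α n)} {2^- (suc n)}
                   (Φseq-digits-Dist≤ {g} {x} x∈[0,1] guides n) j)
                (Dist≤⇒≈ {x} {ℚ→ℝ (proj₁ (g n))} {proj₂ (g n)} (proj₁ (guides n)) j)))
  where
  α = digits g
  h = 2^- (2 ℕ.+ n)

Φ-digits≃ : ∀ {g x} → In01 x → Guides g x → proj₁ (Φ (digits g)) ≃ʳ x
Φ-digits≃ {g} {x} x∈[0,1] guides =
  approximants⇒≃ʳ {x} {proj₁ (Φ (digits g))} (Φseq-digits-Dist≤ {g} {x} x∈[0,1] guides)

applyUpTo-cong : ∀ {A : Set} {f g : ℕ → A} m → (∀ n → n ℕ.< m → f n ≡ g n) →
                 applyUpTo f m ≡ applyUpTo g m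
applyUpTo-cong zero    f≡g = refl
applyUpTo-cong (suc m) f≡g =
  cong₂ _∷_ (f≡g zero (ℕ.s≤s ℕ.z≤n)) (applyUpTo-cong m (λ n n<m → f≡g (suc n) (ℕ.s≤s n<m)))

digits-prefix : ∀ {g g′} m → (∀ n → n ℕ.< m → g n ≡ g′ n) →
                initSeg (digits g) m ≡ initSeg (digits g′) m
digits-prefix {g} {g′} m g≡g′ = applyUpTo-cong m digits≡
  where
  numerator≡ : ∀ n → n ℕ.≤ m → numerator g n ≡ numerator g′ n
  digits≡ : ∀ n → n ℕ.< m → digits g n ≡ digits g′ n
  numerator≡ zero    _   = refl
  numerator≡ (suc n) n<m =
    cong₂ (λ M i → (+ 2) ℤ.* M ℤ.+ cF i) (numerator≡ n (ℕP.<⇒≤ n<m)) (digits≡ n n<m)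
  digits≡ n n<m = cong₂ (λ M b → digit ((M ℚ./ 2 ℕ.^ suc n) {{2^n≢0 (suc n)}}) (proj₁ b) (proj₂ b))
                        (numerator≡ n (ℕP.<⇒≤ n<m)) (g≡g′ n n<m)

startWith : ℕ → ℚᵘ × ℚᵘ → Guide → Guide
startWith m b g n with n ℕ.<? m
... | yes _ = b
... | no  _ = g n

startWith-< : ∀ {m b g n} → n ℕ.< m → startWith m b g n ≡ b
startWith-< {m} {n = n} n<m with n ℕ.<? m
... | yes _   = refl
... | no n≮m = contradiction n<m n≮m

startWith-guides : ∀ {m b g x} → (∀ n → n ℕ.< m → GuidesAt n b x) → Guides g x →
                   Guides (startWith m b g) x
startWith-guides {m} b-guides g-guides n with n ℕ.<? m
... | yes n<m = b-guides n n<m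
... | no  _   = g-guides n

approximantGuide : ℝ → Guide
approximantGuide x n = seq x (3 ℕ.+ n) , 2^- (3 ℕ.+ n)

approximantGuide-guides : ∀ x → Guides (approximantGuide x) x
approximantGuide-guides x n =
  Dist≤-approximant x (3 ℕ.+ n) , ℚP.≤-reflexive (2^-‿halves (2 ℕ.+ n))

-- Both points lie within 2^-(m+2) of x_(m+3), an interval short enough to guide
-- the first m digits of either of them.
close⇒common-prefix : ∀ m (x y : I01) → Dist≤ (proj₁ x) (proj₁ y) (2^- (3 ℕ.+ m)) →
  Σ[ α ∈ 𝟛ᴺ ] Σ[ β ∈ 𝟛ᴺ ]
    initSeg α m ≡ initSeg β m × proj₁ (Φ α) ≃ʳ proj₁ x × proj₁ (Φ β) ≃ʳ proj₁ y
close⇒common-prefix m (x , x∈[0,1]) (y , y∈[0,1]) x~y =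
    digits gˣ , digits gʸ
  , digits-prefix m (λ n n<m → trans (startWith-< n<m) (sym (startWith-< n<m)))
  , Φ-digits≃ {gˣ} {x} x∈[0,1] (guided x x~a)
  , Φ-digits≃ {gʸ} {y} y∈[0,1] (guided y y~a)
  where
  a = seq x (3 ℕ.+ m)
  ρ = 2^- (2 ℕ.+ m)
  gˣ = startWith m (a , ρ) (approximantGuide x)
  gʸ = startWith m (a , ρ) (approximantGuide y)
  x~a : Dist≤ x (ℚ→ℝ a) ρ
  x~a = Dist≤-mono {x} {ℚ→ℝ a} (2^-‿suc≤ (2 ℕ.+ m)) (Dist≤-approximant x (3 ℕ.+ m))
  y~a : Dist≤ y (ℚ→ℝ a) ρ
  y~a = Dist≤-mono {y} {ℚ→ℝ a} (ℚP.≤-reflexive (2^-‿halves (2 ℕ.+ m)))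
          (Dist≤-trans {y} {x} {ℚ→ℝ a} {2^- (3 ℕ.+ m)} {2^- (3 ℕ.+ m)}
            (Dist≤-sym {x} {y} {2^- (3 ℕ.+ m)} x~y) (Dist≤-approximant x (3 ℕ.+ m)))
  short : ∀ {n} → n ℕ.< m → ρ + ρ ≤ 2^- (2 ℕ.+ n)
  short n<m = ℚP.≤-trans (ℚP.≤-reflexive (2^-‿halves (suc m))) (2^-‿antitone (ℕ.s≤s n<m))
  guided : ∀ z → Dist≤ z (ℚ→ℝ a) ρ → Guides (startWith m (a , ρ) (approximantGuide z)) z
  guided z z~a = startWith-guides {m} {a , ρ} {approximantGuide z} {z}
                     (λ n n<m → z~a , short n<m) (approximantGuide-guides z)

theorem4p12 : (f : I01 → ℝ) → RespectsEq f →
    (UniformlyContinuousI f ⇔ UniformlyContinuous𝟛 (f ∘ Φ))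
theorem4p12 f resp = mk⇔ forward backward
  where
  forward : UniformlyContinuousI f → UniformlyContinuous𝟛 (f ∘ Φ)
  forward (ω , f-uc) = suc ∘ ω , λ k α β same →
    f-uc k (Φ α) (Φ β) (Φ-prefix-Dist≤ α β (ω k) same)

  backward : UniformlyContinuous𝟛 (f ∘ Φ) → UniformlyContinuousI f
  backward (ω , fΦ-uc) = (λ k → 3 ℕ.+ ω k) , λ k x y x~y →
    let α , β , same , α≃x , β≃y = close⇒common-prefix (ω k) x y x~y
    in Dist≤-resp-≃ʳ {f (Φ α)} {f x} {f (Φ β)} {f y} {2^- k}
         (resp (Φ α) x α≃x) (resp (Φ β) y β≃y) (fΦ-uc k α β same)
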